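{- Let $n\ge1$, $k\ge2$, $x\in[k]^{n-1}$ and $\sigma\in[k]$ with $\sigma<k-1$. Then $val((\sigma+1)x)-val(x\sigma)\ge k^{head(x\sigma)}$.
   Context: $[k]=\{0,\dots,k-1\}$; words written by concatenation. For $s=\sigma_0\cdots\sigma_{n-1}\in[k]^n$ and $0\le m<n$: $val(s,m)=\sum_{i=1}^n \sigma_{(m-i)\bmod n}k^{i-1}$; $val(s)=\max_{0\le m<n} val(s,m)$; $head(s)=\min\{m\in\{0,\dots,n-1\} : val(s,m)=val(s)\}$. -}

module Defs where

open import Data.Nat using (ℕ; zero; suc; _+_; _*_; _∸_; _^_; _⊔_; _≟_; NonZero)
open import Data.Nat.DivMod using (_%_)
open import Data.Fin using (Fin; toℕ; fromℕ<)
open import Data.Vec using (Vec; lookup)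
open import Data.Nat.DivMod using (m%n<n)
open import Relation.Nullary using (yes; no)

Word : ℕ → ℕ → Set
Word k n = Vec (Fin k) n

sum1 : ℕ → (ℕ → ℕ) → ℕ
sum1 zero    f = 0
sum1 (suc N) f = sum1 N f + f (suc N)

letter : ∀ {k n} → Word k (suc n) → ℕ → ℕ
letter {k} {n} s j = toℕ (lookup s (fromℕ< (m%n<n j (suc n))))

-- val(s,m) = Σ_{i=1}^{n} σ_{(m-i) mod n} k^{i-1}, for m < n
-- (m - i) mod n is computed as (m + n - i) mod n, valid since 1 ≤ i ≤ n.
valAt : ∀ {k n} → Word k (suc n) → ℕ → ℕ
valAt {k} {n} s m = sum1 (suc n) (λ i → letter s ((m + suc n) ∸ i) * k ^ (i ∸ 1))

maxUpTo : ∀ {k n} → Word k (suc n) → ℕ → ℕ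
maxUpTo s zero    = 0
maxUpTo s (suc N) = maxUpTo s N ⊔ valAt s N

val : ∀ {k n} → Word k (suc n) → ℕ
val {k} {n} s = maxUpTo s (suc n)

-- least m < N with val(s,m) = val(s) (returns N if none)
firstMax : ∀ {k n} → Word k (suc n) → ℕ → ℕ
firstMax s zero = zero
firstMax s (suc N) with firstMax s N ≟ N
... | no _  = firstMax s N
... | yes _ with valAt s N ≟ val s
...   | yes _ = N
...   | no _  = suc N

head : ∀ {k n} → Word k (suc n) → ℕ
head {k} {n} s = firstMax s (suc n)

-- Let s = xσ and t = (σ+1)x, of length N. Reading t one position further on than s, the letters of
-- t dominate those of s, and they agree everywhere except at the position of σ, where t has σ+1.
-- In val(s, h) with h = head s that position carries the weight k^h, so val(t, h+1) ≥ val(s) + k^h,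
-- and val(t, h+1) ≤ val(t) because val(t, m) only depends on m mod N.
module Submission where

open import Defs
open import Data.Nat using (ℕ; zero; suc; NonZero; s<s⁻¹; _+_; _*_; _∸_; _^_; _≤_; _<_; z≤n; s≤s)
open import Data.Nat.Properties
open import Data.Nat.DivMod using (_%_; m%n<n; m%n%n≡m%n; m<n⇒m%n≡m; n%n≡0; %-distribˡ-+)
open import Data.Fin using (Fin; toℕ; fromℕ<)
open import Data.Fin.Properties using (toℕ-fromℕ<; fromℕ<-cong)
open import Data.Vec using (Vec; []; _∷_; _∷ʳ_; lookup)
open import Data.Product using (Σ-syntax; _×_; _,_; proj₁; proj₂)
open import Data.Sum using (_⊎_; inj₁; inj₂)
open import Relation.Nullary using (yes; no)
open import Relation.Binary.PropositionalEquality
open import Data.Empty using (⊥-elim)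

sum1-cong : ∀ N {f g : ℕ → ℕ} → (∀ i → 1 ≤ i → i ≤ N → f i ≡ g i) → sum1 N f ≡ sum1 N g
sum1-cong zero    f≡g = refl
sum1-cong (suc N) f≡g =
  cong₂ _+_ (sum1-cong N (λ i 1≤i i≤N → f≡g i 1≤i (m≤n⇒m≤1+n i≤N))) (f≡g (suc N) (s≤s z≤n) ≤-refl)

sum1-mono-≤ : ∀ N {f g : ℕ → ℕ} → (∀ i → 1 ≤ i → i ≤ N → f i ≤ g i) → sum1 N f ≤ sum1 N g
sum1-mono-≤ zero    f≤g = z≤n
sum1-mono-≤ (suc N) f≤g =
  +-mono-≤ (sum1-mono-≤ N (λ i 1≤i i≤N → f≤g i 1≤i (m≤n⇒m≤1+n i≤N))) (f≤g (suc N) (s≤s z≤n) ≤-refl)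

sum1-mono-≤-+ : ∀ N {f g : ℕ → ℕ} c {i₀} → 1 ≤ i₀ → i₀ ≤ N →
                (∀ i → 1 ≤ i → i ≤ N → f i ≤ g i) → f i₀ + c ≤ g i₀ → sum1 N f + c ≤ sum1 N g
sum1-mono-≤-+ zero    c (s≤s _) ()
sum1-mono-≤-+ (suc N) {f} {g} c {i₀} 1≤i₀ i₀≤1+N f≤g gap with m≤n⇒m<n∨m≡n i₀≤1+N
... | inj₂ refl = begin
  sum1 N f + f (suc N) + c   ≡⟨ +-assoc (sum1 N f) (f (suc N)) c ⟩
  sum1 N f + (f (suc N) + c) ≤⟨ +-mono-≤ (sum1-mono-≤ N f≤g′) gap ⟩
  sum1 N g + g (suc N)       ∎
  where open ≤-Reasoning
        f≤g′ = λ i 1≤i i≤N → f≤g i 1≤i (m≤n⇒m≤1+n i≤N)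
... | inj₁ (s≤s i₀≤N) = begin
  sum1 N f + f (suc N) + c   ≡⟨ +-assoc (sum1 N f) (f (suc N)) c ⟩
  sum1 N f + (f (suc N) + c) ≡⟨ cong (sum1 N f +_) (+-comm (f (suc N)) c) ⟩
  sum1 N f + (c + f (suc N)) ≡⟨ +-assoc (sum1 N f) c (f (suc N)) ⟨
  sum1 N f + c + f (suc N)   ≤⟨ +-mono-≤ (sum1-mono-≤-+ N c 1≤i₀ i₀≤N f≤g′ gap) (f≤g (suc N) (s≤s z≤n) ≤-refl) ⟩
  sum1 N g + g (suc N)       ∎
  where open ≤-Reasoning
        f≤g′ = λ i 1≤i i≤N → f≤g i 1≤i (m≤n⇒m≤1+n i≤N)

lookup-∷ʳ-last : ∀ {A : Set} {n} (xs : Vec A n) (y : A) .(n<1+n : n < suc n) →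
                 lookup (xs ∷ʳ y) (fromℕ< n<1+n) ≡ y
lookup-∷ʳ-last []       y _     = refl
lookup-∷ʳ-last (x ∷ xs) y 1+n<2+n = lookup-∷ʳ-last xs y (s<s⁻¹ 1+n<2+n)

lookup-∷ʳ-init : ∀ {A : Set} {n} (xs : Vec A n) (y : A) {i} .(i<n : i < n) .(i<1+n : i < suc n) →
                 lookup (xs ∷ʳ y) (fromℕ< i<1+n) ≡ lookup xs (fromℕ< i<n)
lookup-∷ʳ-init (x ∷ xs) y {zero}  _   _     = refl
lookup-∷ʳ-init (x ∷ xs) y {suc i} i<n i<1+n = lookup-∷ʳ-init xs y (s<s⁻¹ i<n) (s<s⁻¹ i<1+n)

%-cong-+ : ∀ {m m′ n n′} d .{{_ : NonZero d}} → m % d ≡ m′ % d → n % d ≡ n′ % d →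
           (m + n) % d ≡ (m′ + n′) % d
%-cong-+ {m} {m′} {n} {n′} d m≡m′ n≡n′ = begin
  (m + n) % d             ≡⟨ %-distribˡ-+ m n d ⟩
  (m % d + n % d) % d     ≡⟨ cong₂ (λ a b → (a + b) % d) m≡m′ n≡n′ ⟩
  (m′ % d + n′ % d) % d   ≡⟨ %-distribˡ-+ m′ n′ d ⟨
  (m′ + n′) % d           ∎
  where open ≡-Reasoning

module _ {k n : ℕ} (v : Word k (suc n)) where

  letter-cong-mod : ∀ {i j} → i % suc n ≡ j % suc n → letter v i ≡ letter v j
  letter-cong-mod {i} {j} i≡j =
    cong (λ a → toℕ (lookup v a)) (fromℕ<-cong _ _ i≡j (m%n<n i (suc n)) (m%n<n j (suc n)))

  letter-lookup : ∀ {j} (j<1+n : j < suc n) → letter v j ≡ toℕ (lookup v (fromℕ< j<1+n))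
  letter-lookup {j} j<1+n =
    cong (λ a → toℕ (lookup v a)) (fromℕ<-cong _ _ (m<n⇒m%n≡m j<1+n) (m%n<n j (suc n)) j<1+n)

  letter-mod : ∀ j → letter v (j % suc n) ≡ letter v j
  letter-mod j = letter-cong-mod {j % suc n} {j} (m%n%n≡m%n j (suc n))

  letter-suc-mod : ∀ j → letter v (suc j) ≡ letter v (suc (j % suc n))
  letter-suc-mod j = letter-cong-mod {suc j} {suc (j % suc n)}
    (%-cong-+ {1} {1} {j} (suc n) refl (sym (m%n%n≡m%n j (suc n))))

  valAt-mod : ∀ m → valAt v (m % suc n) ≡ valAt v m
  valAt-mod m = sum1-cong (suc n) λ i _ i≤1+n →
    cong (_* k ^ (i ∸ 1)) (letter-cong-mod {m % suc n + suc n ∸ i} {m + suc n ∸ i} (begin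
      (m % suc n + suc n ∸ i) % suc n   ≡⟨ cong (_% suc n) (+-∸-assoc (m % suc n) i≤1+n) ⟩
      (m % suc n + (suc n ∸ i)) % suc n ≡⟨ %-cong-+ {m % suc n} {m} {suc n ∸ i} (suc n) (m%n%n≡m%n m (suc n)) refl ⟩
      (m + (suc n ∸ i)) % suc n         ≡⟨ cong (_% suc n) (+-∸-assoc m i≤1+n) ⟨
      (m + suc n ∸ i) % suc n           ∎))
    where open ≡-Reasoning

  valAt≤maxUpTo : ∀ {j M} → j < M → valAt v j ≤ maxUpTo v M
  valAt≤maxUpTo {M = suc M} (s≤s j≤M) with m≤n⇒m<n∨m≡n j≤M
  ... | inj₁ j<M  = ≤-trans (valAt≤maxUpTo j<M) (m≤m⊔n _ _)
  ... | inj₂ refl = m≤n⊔m _ _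

  valAt≤val : ∀ m → valAt v m ≤ val v
  valAt≤val m = subst (_≤ val v) (valAt-mod m) (valAt≤maxUpTo (m%n<n m (suc n)))

  maxUpTo-attained : ∀ M → Σ[ j ∈ ℕ ] j ≤ M × maxUpTo v (suc M) ≡ valAt v j
  maxUpTo-attained zero = 0 , z≤n , refl
  maxUpTo-attained (suc M) with ⊔-sel (maxUpTo v (suc M)) (valAt v (suc M))
  ... | inj₂ max≡ = suc M , ≤-refl , max≡
  ... | inj₁ max≡ with maxUpTo-attained M
  ... | j , j≤M , max≡′ = j , m≤n⇒m≤1+n j≤M , trans max≡ max≡′

  firstMax-spec : ∀ M → (firstMax v M ≡ M × (∀ j → j < M → valAt v j ≢ val v))
                      ⊎ (firstMax v M < M × valAt v (firstMax v M) ≡ val v)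
  firstMax-spec zero = inj₁ (refl , λ _ ())
  firstMax-spec (suc M) with firstMax v M ≟ M | firstMax-spec M
  ... | no  f≢M | inj₁ (f≡M , _)  = ⊥-elim (f≢M f≡M)
  ... | no  _   | inj₂ (f<M , hit) = inj₂ (m≤n⇒m≤1+n f<M , hit)
  ... | yes f≡M | inj₂ (f<M , _)  = ⊥-elim (<-irrefl f≡M f<M)
  ... | yes _   | inj₁ (_ , miss) with valAt v M ≟ val v
  ...   | yes hit = inj₂ (≤-refl , hit)
  ...   | no  M-miss = inj₁ (refl , miss′)
    where
    miss′ : ∀ j → j < suc M → valAt v j ≢ val v
    miss′ j (s≤s j≤M) with m≤n⇒m<n∨m≡n j≤M
    ... | inj₁ j<M  = miss j j<M
    ... | inj₂ refl = M-miss

  head-spec : head v < suc n × valAt v (head v) ≡ val v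
  head-spec with firstMax-spec (suc n)
  ... | inj₂ found = found
  ... | inj₁ (_ , miss) with maxUpTo-attained n
  ...   | j , j≤n , val≡ = ⊥-elim (miss j (s≤s j≤n) (sym val≡))

module _ {p k : ℕ} (x : Vec (Fin k) p) (σ : Fin k) (σ+1<k : suc (toℕ σ) < k) where

  s t : Word k (suc p)
  s = x ∷ʳ σ
  t = fromℕ< σ+1<k ∷ x

  letter-shift-init : ∀ {r} → r < p → letter t (suc r) ≡ letter s r
  letter-shift-init {r} r<p = begin
    letter t (suc r)                   ≡⟨ letter-lookup t (s≤s r<p) ⟩
    toℕ (lookup x (fromℕ< r<p))        ≡⟨ cong toℕ (lookup-∷ʳ-init x σ r<p r<1+p) ⟨
    toℕ (lookup s (fromℕ< r<1+p))      ≡⟨ letter-lookup s r<1+p ⟨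
    letter s r                         ∎
    where open ≡-Reasoning
          r<1+p = m≤n⇒m≤1+n r<p

  letter-shift-last : letter t (suc p) ≡ suc (letter s p)
  letter-shift-last = begin
    letter t (suc p)                             ≡⟨ letter-cong-mod t {suc p} {0} (n%n≡0 (suc p)) ⟩
    letter t 0                                   ≡⟨ toℕ-fromℕ< σ+1<k ⟩
    suc (toℕ σ)                                  ≡⟨ cong (λ a → suc (toℕ a)) (lookup-∷ʳ-last x σ (n<1+n p)) ⟨
    suc (toℕ (lookup s (fromℕ< (n<1+n p))))      ≡⟨ cong suc (letter-lookup s (n<1+n p)) ⟨
    suc (letter s p)                             ∎
    where open ≡-Reasoning

  letter-shift-≥ : ∀ j → letter s j ≤ letter t (suc j)
  letter-shift-≥ j =
    subst₂ _≤_ (letter-mod s j) (sym (letter-suc-mod t j)) (letter-shift-≥-below (m%n<n j (suc p)))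
    where
    letter-shift-≥-below : ∀ {r} → r < suc p → letter s r ≤ letter t (suc r)
    letter-shift-≥-below (s≤s r≤p) with m≤n⇒m<n∨m≡n r≤p
    ... | inj₁ r<p  = ≤-reflexive (sym (letter-shift-init r<p))
    ... | inj₂ refl = subst (letter s p ≤_) (sym letter-shift-last) (n≤1+n _)

  valAt-shift : ∀ {h} → h < suc p → valAt s h + k ^ h ≤ valAt t (suc h)
  valAt-shift {h} h<1+p = begin
    valAt s h + k ^ h
      ≤⟨ sum1-mono-≤-+ (suc p) (k ^ h) (s≤s z≤n) h<1+p
           (λ i _ _ → *-monoˡ-≤ (k ^ (i ∸ 1)) (letter-shift-≥ (h + suc p ∸ i))) gap ⟩
    sum1 (suc p) (λ i → letter t (suc (h + suc p ∸ i)) * k ^ (i ∸ 1))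
      ≡⟨ sum1-cong (suc p) (λ i _ i≤1+p →
           cong (λ a → letter t a * k ^ (i ∸ 1)) (+-∸-assoc 1 (≤-trans i≤1+p (m≤n+m (suc p) h)))) ⟨
    valAt t (suc h) ∎
    where
    open ≤-Reasoning
    index-of-σ : h + suc p ∸ suc h ≡ p
    index-of-σ = trans (cong (_∸ suc h) (+-suc h p)) (m+n∸m≡n h p)
    gap : letter s (h + suc p ∸ suc h) * k ^ h + k ^ h ≤ letter t (suc (h + suc p ∸ suc h)) * k ^ h
    gap rewrite index-of-σ = ≤-reflexive (trans (+-comm _ (k ^ h)) (cong (_* k ^ h) (sym letter-shift-last)))

claim23 : (m k : ℕ) → 2 ≤ k → (x : Vec (Fin k) m) → (σ : Fin k) → (lt : suc (toℕ σ) < k) →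
    val (x ∷ʳ σ) + k ^ head (x ∷ʳ σ) ≤ val (fromℕ< lt ∷ x)
claim23 m k _ x σ lt = begin
  val (x ∷ʳ σ) + k ^ h             ≡⟨ cong (_+ k ^ h) (proj₂ (head-spec (x ∷ʳ σ))) ⟨
  valAt (x ∷ʳ σ) h + k ^ h         ≤⟨ valAt-shift x σ lt (proj₁ (head-spec (x ∷ʳ σ))) ⟩
  valAt (fromℕ< lt ∷ x) (suc h)    ≤⟨ valAt≤val (fromℕ< lt ∷ x) (suc h) ⟩
  val (fromℕ< lt ∷ x)              ∎
  where open ≤-Reasoning
        h = head (x ∷ʳ σ)
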